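{- For every positive integer $m$, let $k_m$ be the order of the kernel of $\iota_*:\mathrm{Cl}^+(\mathbb{Z}[\gamma_m])\to\mathrm{Cl}^+(R_m)$, $[I,\kappa]\mapsto[IR_m,\kappa]$, and let $\omega(m)$ be the number of distinct prime divisors of $m$. Then $k_m\ge\omega(m)-3$.
   Context: Let $K_m = \mathbb{Q}[x]/(x^2-x+m)$ and let $\gamma_m$ be the image of $x$ (so $\gamma_m=\frac{1+\sqrt{1-4m}}{2}$). Let $A_0=\mathbb{Z}[\gamma_m]$ (over base $\mathbb{Z}$) and $R_m=\mathbb{Z}[\frac{1}{m},\gamma_m]$ (over base $B=\mathbb{Z}[\frac1m]$). For $A$ one of these rings with base $B$, a fractional ideal is a finitely generated $A$-submodule $I\subset K_m$ with $I\otimes\mathbb{Q}=K_m$; its norm $N(I)$ is the fractional $B$-ideal with $\bigwedge^2_B I = N(I)\cdot\bigwedge^2_B A$. An oriented ideal class of $A$ is an equivalence class $[I,\kappa]$ of pairs with $I$ a fractional ideal and $\kappa\in\mathbb{Q}^\times$ a generator of $N(I)$, modulo $(I,\kappa)\sim(\alpha I, N(\alpha)\kappa)$ for invertible $\alpha\in K_m$. The classes with $I$ invertible form the group $\mathrm{Cl}^+(A)$ under $[I,\kappa][J,\lambda]=[IJ,\kappa\lambda]$. -}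

module Defs where

open import Data.Nat as ℕ using (ℕ; _^_)
open import Data.Nat.Primality using (Prime; prime?)
open import Data.Nat.Divisibility using (_∣_; _∣?_)
open import Data.Integer as ℤ using (ℤ; +_)
open import Data.Rational as ℚ using (ℚ; _/_; 0ℚ; 1ℚ)
open import Data.Product using (Σ; ∃; ∃-syntax; _×_; _,_)
open import Data.List using (List; filter; length; upTo)
open import Data.Vec using (Vec; zipWith; foldr; map; []; _∷_)
open import Data.Vec.Relation.Unary.All as VAll using ()
open import Relation.Binary.PropositionalEquality using (_≡_; _≢_)
open import Relation.Nullary.Decidable using (_×-dec_)
open import Function.Bundles using (_⇔_)

-- ω(m): number of distinct prime divisors of m
-- (primes p ≤ m with p ∣ m; for m ≥ 1 every prime divisor is ≤ m)

ω : ℕ → ℕ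
ω m = length (filter (λ p → prime? p ×-dec p ∣? m) (upTo (ℕ.suc m)))

-- The field K_m = ℚ[x]/(x² - x + m).  An element (a , b) stands for
-- a + b·γ_m, where γ_m is the image of x, so γ_m² = γ_m - m.

K : Set
K = ℚ × ℚ

module Field (m : ℕ) where

  mℚ : ℚ
  mℚ = (+ m) / 1

  0K : K
  0K = (0ℚ , 0ℚ)

  1K : K
  1K = (1ℚ , 0ℚ)

  _+K_ : K → K → K
  (a , b) +K (c , d) = (a ℚ.+ c , b ℚ.+ d)

  -- (a + bγ)(c + dγ) = ac - m bd + (ad + bc + bd) γ
  _*K_ : K → K → K
  (a , b) *K (c , d) =
    (a ℚ.* c ℚ.- mℚ ℚ.* (b ℚ.* d) , a ℚ.* d ℚ.+ b ℚ.* c ℚ.+ b ℚ.* d)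

  -- field norm N(a + bγ) = (a + bγ)(a + bγ') = a² + ab + m b²
  NK : K → ℚ
  NK (a , b) = a ℚ.* a ℚ.+ a ℚ.* b ℚ.+ mℚ ℚ.* (b ℚ.* b)

  -- determinant w.r.t. the basis (1 , γ) (a basis of A over B in both cases):
  -- x ∧ y = det x y · (1 ∧ γ)
  det : K → K → ℚ
  det (a , b) (c , d) = a ℚ.* d ℚ.- b ℚ.* c

  sumK : ∀ {n} → Vec K n → K
  sumK = foldr _ _+K_ 0K

  sumℚ : ∀ {n} → Vec ℚ n → ℚ
  sumℚ = foldr _ ℚ._+_ 0ℚ

  IsZ : ℚ → Set
  IsZ q = ∃[ z ] q ≡ z / 1

  IsZ1/m : ℚ → Set
  IsZ1/m q = ∃[ k ] ∃[ z ] q ℚ.* ((+ (m ^ k)) / 1) ≡ z / 1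

  -- A = B[γ] = B ⊕ B γ  (for B = ℤ: A₀ = ℤ[γ]; for B = ℤ[1/m]: R_m)
  InOrder : (ℚ → Set) → K → Set
  InOrder B (a , b) = B a × B b

  -- Finitely generated A-submodules of K, given by a generating vector.

  record Gens : Set where
    constructor gens
    field
      size : ℕ
      elems : Vec K size
  open Gens public

  _∈⟨_⟩_ : K → (ℚ → Set) → Gens → Set
  x ∈⟨ B ⟩ g = Σ (Vec K (size g)) λ cs →
    VAll.All (InOrder B) cs × x ≡ sumK (zipWith _*K_ cs (elems g))

  SameModule : (ℚ → Set) → Gens → Gens → Set
  SameModule B g h = ∀ x → (x ∈⟨ B ⟩ g) ⇔ (x ∈⟨ B ⟩ h)

  unitIdeal : Gens
  unitIdeal = gens 1 (1K ∷ [])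

  scale : K → Gens → Gens
  scale α (gens n v) = gens n (map (α *K_) v)

  prodIdeal : Gens → Gens → Gens
  prodIdeal (gens n v) (gens k w) =
    gens (n ℕ.* k) (Data.Vec.concat (map (λ x → map (x *K_) w) v))

  -- I ⊗ ℚ = K : I contains two ℚ-linearly independent elements
  FullRank : (ℚ → Set) → Gens → Set
  FullRank B g = ∃[ x ] ∃[ y ] (x ∈⟨ B ⟩ g) × (y ∈⟨ B ⟩ g) × det x y ≢ 0ℚ

  FracIdeal : (ℚ → Set) → Gens → Set
  FracIdeal B g = FullRank B g

  Invertible : (ℚ → Set) → Gens → Set
  Invertible B g =
    FracIdeal B g × ∃[ h ] FracIdeal B h × SameModule B (prodIdeal g h) unitIdeal

  -- Norm: ⋀²_B I = N(I) · ⋀²_B A, and ⋀²_B A is free on 1 ∧ γ, so N(I) is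
  -- the B-submodule of ℚ generated by { det x y : x , y ∈ I }.

  InNorm : (ℚ → Set) → Gens → ℚ → Set
  InNorm B g κ = ∃[ n ] Σ (Vec ℚ n) λ bs → Σ (Vec K n) λ xs → Σ (Vec K n) λ ys →
    VAll.All B bs × VAll.All (_∈⟨ B ⟩ g) xs × VAll.All (_∈⟨ B ⟩ g) ys ×
    κ ≡ sumℚ (zipWith ℚ._*_ bs (zipWith det xs ys))

  GeneratesNorm : (ℚ → Set) → Gens → ℚ → Set
  GeneratesNorm B g κ =
    κ ≢ 0ℚ × InNorm B g κ ×
    (∀ x y → x ∈⟨ B ⟩ g → y ∈⟨ B ⟩ g → ∃[ b ] B b × det x y ≡ b ℚ.* κ)

  -- an oriented fractional ideal (I , κ) whose ideal is invertible,
  -- i.e. a representative of an element of Cl⁺(A)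
  OrientedInvertible : (ℚ → Set) → Gens × ℚ → Set
  OrientedInvertible B (g , κ) = Invertible B g × GeneratesNorm B g κ

  Equiv : (ℚ → Set) → Gens × ℚ → Gens × ℚ → Set
  Equiv B (g , κ) (h , λ′) =
    ∃[ α ] α ≢ 0K × SameModule B (scale α g) h × λ′ ≡ NK α ℚ.* κ

  -- ι_* : Cl⁺(ℤ[γ]) → Cl⁺(R_m), [I , κ] ↦ [I R_m , κ].  I R_m is the
  -- R_m-module generated by the same generators.  [I , κ] lies in the
  -- kernel iff (I R_m , κ) ∼ (R_m , 1) in the sense of R_m.

  InKernel : Gens × ℚ → Set
  InKernel (g , κ) = Equiv IsZ1/m (g , κ) (unitIdeal , 1ℚ)

open Field public

{-# OPTIONS --safe #-}
module Submission where

-- For a prime p ∣ m with p⁴ < m take 𝔞_p = (p , γ)², with ℤ-basis p² , γ − m, oriented by its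
-- norm p²; it is invertible, its inverse being its conjugate divided by p². In R_m the prime p
-- is a unit, p⁻¹ 𝔞_p = R_m and N(p⁻¹) p² = 1, so [𝔞_p , p²] lies in the kernel of ι_*.
-- If p < q and α 𝔞_p = 𝔞_q with N(α) p² = q², then α p² is an element of 𝔞_q of norm p² q².
-- But an element x + y γ of 𝔞_q with y ≠ 0 has norm ≥ m, because 4 N = (2x + y)² + (4m − 1) y²,
-- and a nonzero integer in 𝔞_q is a multiple of q², of norm ≥ q⁴; both exceed p² q².
-- Finally, four primes p < q < r < s dividing m with p⁴ ≥ m are impossible, as p⁴ < p q r s ≤ m,
-- so at least ω(m) − 3 prime divisors are small and give pairwise distinct kernel classes.

open import Defs
open import Data.Empty using (⊥; ⊥-elim)
open import Data.Fin using (Fin; #_)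
open import Data.Integer as ℤ using (ℤ; +_; -[1+_])
import Data.Integer.Properties as ℤP
import Data.Integer.Tactic.RingSolver as ℤSolver
import Data.List as List
open import Data.List using (List; []; _∷_; filter; length; upTo)
import Data.List.Properties as ListP
open import Data.List.Relation.Unary.All as All using (All; []; _∷_)
import Data.List.Relation.Unary.All.Properties as AllP
open import Data.List.Relation.Unary.AllPairs using (AllPairs; []; _∷_)
import Data.List.Relation.Unary.AllPairs.Properties as APP
open import Data.Nat as ℕ using (ℕ; suc; zero; _^_; _≤_; _<_; _∸_; s≤s; z≤n)
open import Data.Nat.Coprimality as Coprimality using (1-coprimeTo)
open import Data.Nat.Divisibility using (_∣_; _∣?_; divides; 1∣_; ∣1⇒≡1; ∣⇒≤; *-monoˡ-∣; m∣n⇒n≡m*quotient)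
open import Data.Nat.ListAction using (product)
open import Data.Nat.Primality using (Prime; prime?; prime⇒nonZero; prime⇒nonTrivial; prime⇒irreducible; euclidsLemma)
import Data.Nat.Properties as ℕP
import Data.Nat.Tactic.RingSolver as ℕSolver
open import Data.Product using (Σ; _×_; _,_; ∃-syntax; proj₁; proj₂)
open import Data.Rational as ℚ using (ℚ; mkℚ; _/_; 0ℚ; 1ℚ; toℚᵘ)
import Data.Rational.Properties as ℚP
open import Data.Rational.Solver using (module +-*-Solver)
import Data.Rational.Unnormalised as ℚᵘ
import Data.Rational.Unnormalised.Properties as ℚᵘP
open import Data.Sum using (_⊎_; inj₁; inj₂; [_,_]′)
open import Data.Vec as Vec using (Vec; []; _∷_; zipWith; lookup)
open import Data.Vec.Relation.Unary.All as VAll using ([]; _∷_)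
import Data.Vec.Relation.Unary.All.Properties as VAllP
open import Function using (id)
open import Function.Bundles using (mk⇔; Equivalence)
open import Relation.Binary using (Rel)
open import Relation.Binary.PropositionalEquality
open import Relation.Nullary using (¬_; yes; no)
open import Relation.Nullary.Decidable using (_×-dec_)
open import Relation.Unary using (Pred; Decidable; ∁)
open import Relation.Unary.Properties using (∁?)

open +-*-Solver

fromℤ : ℤ → ℚ
fromℤ z = z / 1

fromℤ≡mkℚ : ∀ z → fromℤ z ≡ mkℚ z 0 (Coprimality.sym (1-coprimeTo ℤ.∣ z ∣))
fromℤ≡mkℚ (+ n) = ℚP.normalize-coprime (Coprimality.sym (1-coprimeTo n))
fromℤ≡mkℚ -[1+ n ] = cong ℚ.-_ (ℚP.normalize-coprime (Coprimality.sym (1-coprimeTo (suc n))))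

toℚᵘ-fromℤ : ∀ z → toℚᵘ (fromℤ z) ℚᵘ.≃ ℚᵘ.mkℚᵘ z 0
toℚᵘ-fromℤ z = ℚᵘP.≃-reflexive (cong toℚᵘ (fromℤ≡mkℚ z))

fromℤ-injective : ∀ {a b} → fromℤ a ≡ fromℤ b → a ≡ b
fromℤ-injective {a} {b} eq with trans (sym (fromℤ≡mkℚ a)) (trans eq (fromℤ≡mkℚ b))
... | refl = refl

fromℤ-homo-+ : ∀ a b → fromℤ (a ℤ.+ b) ≡ fromℤ a ℚ.+ fromℤ b
fromℤ-homo-+ a b = ℚP.toℚᵘ-injective (ℚᵘP.≃-trans (toℚᵘ-fromℤ (a ℤ.+ b))
  (ℚᵘP.≃-trans (ℚᵘ.*≡* (cong (ℤ._* + 1) (cong₂ ℤ._+_ (sym (ℤP.*-identityʳ a)) (sym (ℤP.*-identityʳ b)))))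
  (ℚᵘP.≃-sym (ℚᵘP.≃-trans (ℚP.toℚᵘ-homo-+ (fromℤ a) (fromℤ b))
    (ℚᵘP.+-cong (toℚᵘ-fromℤ a) (toℚᵘ-fromℤ b))))))

fromℤ-homo-* : ∀ a b → fromℤ (a ℤ.* b) ≡ fromℤ a ℚ.* fromℤ b
fromℤ-homo-* a b = ℚP.toℚᵘ-injective (ℚᵘP.≃-trans (toℚᵘ-fromℤ (a ℤ.* b))
  (ℚᵘP.≃-sym (ℚᵘP.≃-trans (ℚP.toℚᵘ-homo-* (fromℤ a) (fromℤ b))
    (ℚᵘP.*-cong (toℚᵘ-fromℤ a) (toℚᵘ-fromℤ b)))))

fromℤ-homo‿- : ∀ a → fromℤ (ℤ.- a) ≡ ℚ.- fromℤ a
fromℤ-homo‿- a = ℚP.toℚᵘ-injective (ℚᵘP.≃-trans (toℚᵘ-fromℤ (ℤ.- a))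
  (ℚᵘP.≃-sym (ℚᵘP.≃-trans (ℚP.toℚᵘ-homo‿- (fromℤ a)) (ℚᵘP.-‿cong (toℚᵘ-fromℤ a)))))

fromℤ-homo-- : ∀ a b → fromℤ (a ℤ.- b) ≡ fromℤ a ℚ.- fromℤ b
fromℤ-homo-- a b = trans (fromℤ-homo-+ a (ℤ.- b)) (cong (fromℤ a ℚ.+_) (fromℤ-homo‿- b))

fromℤ-*-inverse : ∀ n .{{_ : ℕ.NonZero n}} → fromℤ (+ n) ℚ.* (+ 1 / n) ≡ 1ℚ
fromℤ-*-inverse (suc n) = ℚP.toℚᵘ-injective (ℚᵘP.≃-trans (ℚP.toℚᵘ-homo-* (fromℤ (+ suc n)) (+ 1 / suc n))
  (ℚᵘP.≃-trans (ℚᵘP.*-cong (toℚᵘ-fromℤ (+ suc n)) (ℚᵘP.≃-reflexive (cong toℚᵘ (ℚP.normalize-coprime (1-coprimeTo (suc n))))))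
  (ℚᵘ.*≡* (cong (λ k → + suc k) (ℕSolver.solve (n List.∷ List.[]))))))

ℤ² : Set
ℤ² = ℤ × ℤ

toK : ℤ² → K
toK (a , b) = (fromℤ a , fromℤ b)

_+ℤ²_ : ℤ² → ℤ² → ℤ²
(a , b) +ℤ² (c , d) = (a ℤ.+ c , b ℤ.+ d)

mulℤ² : ℤ → ℤ² → ℤ² → ℤ²
mulℤ² M (a , b) (c , d) = (a ℤ.* c ℤ.- M ℤ.* (b ℤ.* d) , a ℤ.* d ℤ.+ b ℤ.* c ℤ.+ b ℤ.* d)

detℤ² : ℤ² → ℤ² → ℤ
detℤ² (a , b) (c , d) = a ℤ.* d ℤ.- b ℤ.* c

normℤ² : ℤ → ℤ² → ℤ
normℤ² M (a , b) = a ℤ.* a ℤ.+ a ℤ.* b ℤ.+ M ℤ.* (b ℤ.* b)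

-- k · C + y · (γ − M) in the basis (1 , γ)
latticePoint : ℤ → ℤ → ℤ → ℤ → ℤ²
latticePoint C M k y = (k ℤ.* C ℤ.- M ℤ.* y , y)

-- The ℤ solver macro reads its goal without unfolding definitions, hence the identities below
-- are proved for their coordinates written out.
latticePoint-0 : ∀ C M → latticePoint C M (+ 0) (+ 0) ≡ (+ 0 , + 0)
latticePoint-0 C M = cong₂ _,_ first refl
  where
  first : + 0 ℤ.* C ℤ.- M ℤ.* + 0 ≡ + 0
  first = ℤSolver.solve (C List.∷ M List.∷ List.[])

latticePoint-+ : ∀ C M k₁ y₁ k₂ y₂ →
  latticePoint C M k₁ y₁ +ℤ² latticePoint C M k₂ y₂ ≡ latticePoint C M (k₁ ℤ.+ k₂) (y₁ ℤ.+ y₂)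
latticePoint-+ C M k₁ y₁ k₂ y₂ = cong₂ _,_ first refl
  where
  first : k₁ ℤ.* C ℤ.- M ℤ.* y₁ ℤ.+ (k₂ ℤ.* C ℤ.- M ℤ.* y₂) ≡ (k₁ ℤ.+ k₂) ℤ.* C ℤ.- M ℤ.* (y₁ ℤ.+ y₂)
  first = ℤSolver.solve (C List.∷ M List.∷ k₁ List.∷ y₁ List.∷ k₂ List.∷ y₂ List.∷ List.[])

-- γ · c² = c² (γ − m) + m c²  and  γ (γ − m) = (1 − m)(γ − m) − g² c²  when m = c g.
latticePoint-* : ∀ {M} c g → M ≡ c ℤ.* g → ∀ s t k y →
  mulℤ² M (s , t) (latticePoint (c ℤ.* c) M k y) ≡
    latticePoint (c ℤ.* c) M (s ℤ.* k ℤ.+ M ℤ.* t ℤ.* k ℤ.- g ℤ.* g ℤ.* t ℤ.* y)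
      (s ℤ.* y ℤ.+ t ℤ.* (k ℤ.* (c ℤ.* c) ℤ.- M ℤ.* y) ℤ.+ t ℤ.* y)
latticePoint-* c g refl s t k y = cong₂ _,_ first refl
  where
  first : s ℤ.* (k ℤ.* (c ℤ.* c) ℤ.- c ℤ.* g ℤ.* y) ℤ.- c ℤ.* g ℤ.* (t ℤ.* y) ≡
    (s ℤ.* k ℤ.+ c ℤ.* g ℤ.* t ℤ.* k ℤ.- g ℤ.* g ℤ.* t ℤ.* y) ℤ.* (c ℤ.* c)
      ℤ.- c ℤ.* g ℤ.* (s ℤ.* y ℤ.+ t ℤ.* (k ℤ.* (c ℤ.* c) ℤ.- c ℤ.* g ℤ.* y) ℤ.+ t ℤ.* y)
  first = ℤSolver.solve (c List.∷ g List.∷ s List.∷ t List.∷ k List.∷ y List.∷ List.[])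

det-latticePoint : ∀ C M k₁ y₁ k₂ y₂ →
  detℤ² (latticePoint C M k₁ y₁) (latticePoint C M k₂ y₂) ≡ (k₁ ℤ.* y₂ ℤ.- y₁ ℤ.* k₂) ℤ.* C
det-latticePoint C M k₁ y₁ k₂ y₂ = expanded
  where
  expanded : (k₁ ℤ.* C ℤ.- M ℤ.* y₁) ℤ.* y₂ ℤ.- y₁ ℤ.* (k₂ ℤ.* C ℤ.- M ℤ.* y₂) ≡ (k₁ ℤ.* y₂ ℤ.- y₁ ℤ.* k₂) ℤ.* C
  expanded = ℤSolver.solve (C List.∷ M List.∷ k₁ List.∷ y₁ List.∷ k₂ List.∷ y₂ List.∷ List.[])

latticePoint-basis : ∀ C M → latticePoint C M (+ 1) (+ 0) ≡ (C , + 0) × latticePoint C M (+ 0) (+ 1) ≡ (ℤ.- M , + 1)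
latticePoint-basis C M = cong₂ _,_ (ℤSolver.solve (C List.∷ M List.∷ List.[])) refl ,
                         cong₂ _,_ (ℤSolver.solve (C List.∷ M List.∷ List.[])) refl

detℤ²-basis : ∀ C M → detℤ² (C , + 0) (ℤ.- M , + 1) ≡ C
detℤ²-basis C M = expanded
  where
  expanded : C ℤ.* + 1 ℤ.- + 0 ℤ.* ℤ.- M ≡ C
  expanded = ℤSolver.solve (C List.∷ M List.∷ List.[])

_·ℤ²_ : ℤ → ℤ² → ℤ²
c ·ℤ² (p , q) = (c ℤ.* p , c ℤ.* q)

-- Every product of a generator of (c , γ)² with one of its conjugate is divisible by c².
conjugate-products : ∀ {M} c f → M ≡ c ℤ.* f → let c² = c ℤ.* c in
  mulℤ² M (c² , + 0) (c² , + 0) ≡ c² ·ℤ² (c² , + 0) ×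
  mulℤ² M (c² , + 0) (+ 1 ℤ.- M , ℤ.- + 1) ≡ c² ·ℤ² (+ 1 ℤ.- M , ℤ.- + 1) ×
  mulℤ² M (ℤ.- M , + 1) (c² , + 0) ≡ c² ·ℤ² (ℤ.- M , + 1) ×
  mulℤ² M (ℤ.- M , + 1) (+ 1 ℤ.- M , ℤ.- + 1) ≡ c² ·ℤ² (f ℤ.* f , + 0)
conjugate-products c f refl =
  cong₂ _,_ (ℤSolver.solve (c List.∷ f List.∷ List.[])) (ℤSolver.solve (c List.∷ f List.∷ List.[])) ,
  cong₂ _,_ (ℤSolver.solve (c List.∷ f List.∷ List.[])) (ℤSolver.solve (c List.∷ f List.∷ List.[])) ,
  cong₂ _,_ (ℤSolver.solve (c List.∷ f List.∷ List.[])) (ℤSolver.solve (c List.∷ f List.∷ List.[])) ,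
  cong₂ _,_ (ℤSolver.solve (c List.∷ f List.∷ List.[])) (ℤSolver.solve (c List.∷ f List.∷ List.[]))

-- γ − M and its conjugate 1 − M − γ are comaximal: (1 + 2γ)(1 − M − γ) + (3 − 2γ)(γ − M) = 1.
γ-M-comaximal : ∀ M → mulℤ² M (+ 1 , + 2) (+ 1 ℤ.- M , ℤ.- + 1) +ℤ² mulℤ² M (+ 3 , ℤ.- + 2) (ℤ.- M , + 1) ≡ (+ 1 , + 0)
γ-M-comaximal M = cong₂ _,_ first second
  where
  first : + 1 ℤ.* (+ 1 ℤ.- M) ℤ.- M ℤ.* (+ 2 ℤ.* ℤ.- + 1) ℤ.+ (+ 3 ℤ.* ℤ.- M ℤ.- M ℤ.* (ℤ.- + 2 ℤ.* + 1)) ≡ + 1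
  first = ℤSolver.solve (M List.∷ List.[])
  second : + 1 ℤ.* ℤ.- + 1 ℤ.+ + 2 ℤ.* (+ 1 ℤ.- M) ℤ.+ + 2 ℤ.* ℤ.- + 1 ℤ.+ (+ 3 ℤ.* + 1 ℤ.+ ℤ.- + 2 ℤ.* ℤ.- M ℤ.+ ℤ.- + 2 ℤ.* + 1) ≡ + 0
  second = ℤSolver.solve (M List.∷ List.[])

i*i≡+∣i∣*∣i∣ : ∀ i → i ℤ.* i ≡ + (ℤ.∣ i ∣ ℕ.* ℤ.∣ i ∣)
i*i≡+∣i∣*∣i∣ (+ n) = sym (ℤP.pos-* n n)
i*i≡+∣i∣*∣i∣ -[1+ n ] = refl

-- 4 N(x + yγ) = (2x + y)² + (4m − 1) y², so N(x + yγ) ≥ m − 1/4 when y ≠ 0.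
normℤ²-≥ : ∀ m .{{_ : ℕ.NonZero m}} x y n → y ≢ + 0 → + n ≡ normℤ² (+ m) (x , y) → m ≤ n
normℤ²-≥ (suc m) x y n y≢0 n≡N = ℕP.*-cancelˡ-< 4 m n (ℕP.<-≤-trans (ℕP.m<m+n (4 ℕ.* m) {3} (s≤s z≤n)) 4m+3≤4n)
  where
  u w : ℕ
  u = ℤ.∣ + 2 ℤ.* x ℤ.+ y ∣
  w = ℤ.∣ y ∣
  completeSquare : ∀ x y M → + 4 ℤ.* (x ℤ.* x ℤ.+ x ℤ.* y ℤ.+ (+ 1 ℤ.+ M) ℤ.* (y ℤ.* y))
    ≡ (+ 2 ℤ.* x ℤ.+ y) ℤ.* (+ 2 ℤ.* x ℤ.+ y) ℤ.+ (+ 4 ℤ.* M ℤ.+ + 3) ℤ.* (y ℤ.* y)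
  completeSquare x y M = ℤSolver.solve (x List.∷ y List.∷ M List.∷ List.[])
  4n≡u²+[4m+3]w² : 4 ℕ.* n ≡ u ℕ.* u ℕ.+ (4 ℕ.* m ℕ.+ 3) ℕ.* (w ℕ.* w)
  4n≡u²+[4m+3]w² = ℤP.+-injective (begin
    + (4 ℕ.* n)                                   ≡⟨ ℤP.pos-* 4 n ⟩
    + 4 ℤ.* + n                                   ≡⟨ cong (+ 4 ℤ.*_) n≡N ⟩
    + 4 ℤ.* normℤ² (+ suc m) (x , y)              ≡⟨ completeSquare x y (+ m) ⟩
    (+ 2 ℤ.* x ℤ.+ y) ℤ.* (+ 2 ℤ.* x ℤ.+ y) ℤ.+ (+ 4 ℤ.* + m ℤ.+ + 3) ℤ.* (y ℤ.* y)
      ≡⟨ cong₂ (λ a b → a ℤ.+ (b ℤ.+ + 3) ℤ.* (y ℤ.* y)) (i*i≡+∣i∣*∣i∣ (+ 2 ℤ.* x ℤ.+ y)) (sym (ℤP.pos-* 4 m)) ⟩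
    + (u ℕ.* u) ℤ.+ + (4 ℕ.* m ℕ.+ 3) ℤ.* (y ℤ.* y)    ≡⟨ cong (λ b → + (u ℕ.* u) ℤ.+ + (4 ℕ.* m ℕ.+ 3) ℤ.* b) (i*i≡+∣i∣*∣i∣ y) ⟩
    + (u ℕ.* u) ℤ.+ + (4 ℕ.* m ℕ.+ 3) ℤ.* + (w ℕ.* w) ≡⟨ cong (ℤ._+_ (+ (u ℕ.* u))) (sym (ℤP.pos-* (4 ℕ.* m ℕ.+ 3) (w ℕ.* w))) ⟩
    + (u ℕ.* u ℕ.+ (4 ℕ.* m ℕ.+ 3) ℕ.* (w ℕ.* w))  ∎)
    where open ≡-Reasoning
  instance
    w≢0 : ℕ.NonZero w
    w≢0 = ℕ.≢-nonZero (λ w≡0 → y≢0 (ℤP.∣i∣≡0⇒i≡0 w≡0))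
    w²≢0 : ℕ.NonZero (w ℕ.* w)
    w²≢0 = ℕP.m*n≢0 w w
  4m+3≤4n : 4 ℕ.* m ℕ.+ 3 ≤ 4 ℕ.* n
  4m+3≤4n = subst (4 ℕ.* m ℕ.+ 3 ≤_) (sym 4n≡u²+[4m+3]w²)
    (ℕP.≤-trans (ℕP.m≤m*n (4 ℕ.* m ℕ.+ 3) (w ℕ.* w)) (ℕP.m≤n+m _ (u ℕ.* u)))

-- Off ℤ the norm is ≥ m by normℤ²-≥; on ℤ the point is k e², of norm k² e⁴.
latticeNorm-≥ : ∀ m .{{_ : ℕ.NonZero m}} e k y n → n ≢ 0 →
  + n ≡ normℤ² (+ m) (latticePoint (+ e ℤ.* + e) (+ m) k y) → m ≤ n ⊎ e ℕ.* e ℕ.* (e ℕ.* e) ≤ n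
latticeNorm-≥ m e k y n n≢0 n≡N with y ℤ.≟ + 0
... | no y≢0 = inj₁ (normℤ²-≥ m (k ℤ.* (+ e ℤ.* + e) ℤ.- + m ℤ.* y) y n y≢0 n≡N)
... | yes refl = inj₂ (subst (e ℕ.* e ℕ.* (e ℕ.* e) ≤_) (sym n≡∣ke²∣²) (ℕP.*-mono-≤ e²≤∣ke²∣ e²≤∣ke²∣))
  where
  E² = + e ℤ.* + e
  integerNorm : ∀ k E M → (k ℤ.* E ℤ.- M ℤ.* + 0) ℤ.* (k ℤ.* E ℤ.- M ℤ.* + 0) ℤ.+ (k ℤ.* E ℤ.- M ℤ.* + 0) ℤ.* + 0
    ℤ.+ M ℤ.* (+ 0 ℤ.* + 0) ≡ (k ℤ.* E) ℤ.* (k ℤ.* E)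
  integerNorm k E M = ℤSolver.solve (k List.∷ E List.∷ M List.∷ List.[])
  ∣ke²∣≡∣k∣e² : ℤ.∣ k ℤ.* E² ∣ ≡ ℤ.∣ k ∣ ℕ.* (e ℕ.* e)
  ∣ke²∣≡∣k∣e² = trans (ℤP.abs-* k E²) (cong (ℤ.∣ k ∣ ℕ.*_) (ℤP.abs-* (+ e) (+ e)))
  n≡∣ke²∣² : n ≡ ℤ.∣ k ℤ.* E² ∣ ℕ.* ℤ.∣ k ℤ.* E² ∣
  n≡∣ke²∣² = ℤP.+-injective (trans n≡N (trans (integerNorm k E² (+ m)) (i*i≡+∣i∣*∣i∣ (k ℤ.* E²))))
  instance
    ∣k∣≢0 : ℕ.NonZero ℤ.∣ k ∣
    ∣k∣≢0 = ℕ.≢-nonZero (λ ∣k∣≡0 → n≢0 (trans n≡∣ke²∣² (cong (λ z → z ℕ.* z) (trans ∣ke²∣≡∣k∣e² (cong (ℕ._* (e ℕ.* e)) ∣k∣≡0)))))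
  e²≤∣ke²∣ : e ℕ.* e ≤ ℤ.∣ k ℤ.* E² ∣
  e²≤∣ke²∣ = subst (e ℕ.* e ≤_) (sym ∣ke²∣≡∣k∣e²) (ℕP.m≤n*m (e ℕ.* e) ℤ.∣ k ∣)

record IsSubringOfℚ (B : ℚ → Set) : Set where
  field
    fromℤ∈ : ∀ z → B (fromℤ z)
    +-closed : ∀ {p q} → B p → B q → B (p ℚ.+ q)
    *-closed : ∀ {p q} → B p → B q → B (p ℚ.* q)
    neg-closed : ∀ {p} → B p → B (ℚ.- p)

module _ (m : ℕ) where

  infixl 6 _⊕_
  infixl 7 _⊗_

  _⊕_ : K → K → K
  _⊕_ = _+K_ m

  _⊗_ : K → K → K
  _⊗_ = _*K_ m

  toK-homo-+ : ∀ p q → toK (p +ℤ² q) ≡ toK p ⊕ toK q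
  toK-homo-+ (a , b) (c , d) = cong₂ _,_ (fromℤ-homo-+ a c) (fromℤ-homo-+ b d)

  toK-homo-* : ∀ p q → toK (mulℤ² (+ m) p q) ≡ toK p ⊗ toK q
  toK-homo-* (a , b) (c , d) = cong₂ _,_
    (trans (fromℤ-homo-- (a ℤ.* c) (+ m ℤ.* (b ℤ.* d)))
      (cong₂ ℚ._-_ (fromℤ-homo-* a c) (trans (fromℤ-homo-* (+ m) (b ℤ.* d)) (cong (mℚ m ℚ.*_) (fromℤ-homo-* b d)))))
    (trans (fromℤ-homo-+ (a ℤ.* d ℤ.+ b ℤ.* c) (b ℤ.* d))
      (cong₂ ℚ._+_ (trans (fromℤ-homo-+ (a ℤ.* d) (b ℤ.* c)) (cong₂ ℚ._+_ (fromℤ-homo-* a d) (fromℤ-homo-* b c)))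
        (fromℤ-homo-* b d)))

  det-toK : ∀ p q → det m (toK p) (toK q) ≡ fromℤ (detℤ² p q)
  det-toK (a , b) (c , d) =
    sym (trans (fromℤ-homo-- (a ℤ.* d) (b ℤ.* c)) (cong₂ ℚ._-_ (fromℤ-homo-* a d) (fromℤ-homo-* b c)))

  NK-toK : ∀ p → NK m (toK p) ≡ fromℤ (normℤ² (+ m) p)
  NK-toK (a , b) = sym (trans (fromℤ-homo-+ (a ℤ.* a ℤ.+ a ℤ.* b) (+ m ℤ.* (b ℤ.* b)))
    (cong₂ ℚ._+_ (trans (fromℤ-homo-+ (a ℤ.* a) (a ℤ.* b)) (cong₂ ℚ._+_ (fromℤ-homo-* a a) (fromℤ-homo-* a b)))
      (trans (fromℤ-homo-* (+ m) (b ℤ.* b)) (cong (mℚ m ℚ.*_) (fromℤ-homo-* b b)))))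

  ⊗-assoc : ∀ x y z → (x ⊗ y) ⊗ z ≡ x ⊗ (y ⊗ z)
  ⊗-assoc (a , b) (c , d) (e , f) = cong₂ _,_
    (solve 7 (λ a b c d e f M →
      (a :* c :- M :* (b :* d)) :* e :- M :* ((a :* d :+ b :* c :+ b :* d) :* f)
      := a :* (c :* e :- M :* (d :* f)) :- M :* (b :* (c :* f :+ d :* e :+ d :* f))) refl a b c d e f (mℚ m))
    (solve 7 (λ a b c d e f M →
      (a :* c :- M :* (b :* d)) :* f :+ (a :* d :+ b :* c :+ b :* d) :* e :+ (a :* d :+ b :* c :+ b :* d) :* f
      := a :* (c :* f :+ d :* e :+ d :* f) :+ b :* (c :* e :- M :* (d :* f)) :+ b :* (c :* f :+ d :* e :+ d :* f))
      refl a b c d e f (mℚ m))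

  ⊗-comm : ∀ x y → x ⊗ y ≡ y ⊗ x
  ⊗-comm (a , b) (c , d) = cong₂ _,_
    (solve 5 (λ a b c d M → a :* c :- M :* (b :* d) := c :* a :- M :* (d :* b)) refl a b c d (mℚ m))
    (solve 4 (λ a b c d → a :* d :+ b :* c :+ b :* d := c :* b :+ d :* a :+ d :* b) refl a b c d)

  ⊗-distribʳ-⊕ : ∀ x y z → (x ⊕ y) ⊗ z ≡ x ⊗ z ⊕ y ⊗ z
  ⊗-distribʳ-⊕ (a , b) (c , d) (e , f) = cong₂ _,_
    (solve 7 (λ a b c d e f M → (a :+ c) :* e :- M :* ((b :+ d) :* f)
       := (a :* e :- M :* (b :* f)) :+ (c :* e :- M :* (d :* f))) refl a b c d e f (mℚ m))
    (solve 6 (λ a b c d e f → (a :+ c) :* f :+ (b :+ d) :* e :+ (b :+ d) :* f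
       := (a :* f :+ b :* e :+ b :* f) :+ (c :* f :+ d :* e :+ d :* f)) refl a b c d e f)

  ⊗-distribˡ-⊕ : ∀ x y z → z ⊗ (x ⊕ y) ≡ z ⊗ x ⊕ z ⊗ y
  ⊗-distribˡ-⊕ x y z = trans (⊗-comm z (x ⊕ y))
    (trans (⊗-distribʳ-⊕ x y z) (cong₂ _⊕_ (⊗-comm x z) (⊗-comm y z)))

  ⊗-zeroˡ : ∀ x → 0K m ⊗ x ≡ 0K m
  ⊗-zeroˡ (a , b) = cong₂ _,_
    (solve 3 (λ a b M → con 0ℚ :* a :- M :* (con 0ℚ :* b) := con 0ℚ) refl a b (mℚ m))
    (solve 2 (λ a b → con 0ℚ :* b :+ con 0ℚ :* a :+ con 0ℚ :* b := con 0ℚ) refl a b)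

  ⊗-zeroʳ : ∀ x → x ⊗ 0K m ≡ 0K m
  ⊗-zeroʳ x = trans (⊗-comm x (0K m)) (⊗-zeroˡ x)

  ⊗-identityˡ : ∀ x → 1K m ⊗ x ≡ x
  ⊗-identityˡ (a , b) = cong₂ _,_
    (solve 3 (λ a b M → con 1ℚ :* a :- M :* (con 0ℚ :* b) := a) refl a b (mℚ m))
    (solve 2 (λ a b → con 1ℚ :* b :+ con 0ℚ :* a :+ con 0ℚ :* b := b) refl a b)

  ⊗-identityʳ : ∀ x → x ⊗ 1K m ≡ x
  ⊗-identityʳ x = trans (⊗-comm x (1K m)) (⊗-identityˡ x)

  ⊕-identityˡ : ∀ x → 0K m ⊕ x ≡ x
  ⊕-identityˡ (a , b) = cong₂ _,_ (ℚP.+-identityˡ a) (ℚP.+-identityˡ b)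

  ⊕-identityʳ : ∀ x → x ⊕ 0K m ≡ x
  ⊕-identityʳ (a , b) = cong₂ _,_ (ℚP.+-identityʳ a) (ℚP.+-identityʳ b)

  ⊕-interchange : ∀ w x y z → (w ⊕ x) ⊕ (y ⊕ z) ≡ (w ⊕ y) ⊕ (x ⊕ z)
  ⊕-interchange (a , b) (c , d) (e , f) (g , h) = cong₂ _,_
    (solve 4 (λ a c e g → (a :+ c) :+ (e :+ g) := (a :+ e) :+ (c :+ g)) refl a c e g)
    (solve 4 (λ a c e g → (a :+ c) :+ (e :+ g) := (a :+ e) :+ (c :+ g)) refl b d f h)

  NK-homo-* : ∀ x y → NK m (x ⊗ y) ≡ NK m x ℚ.* NK m y
  NK-homo-* (a , b) (c , d) =
    solve 5 (λ a b c d M →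
      let u = a :* c :- M :* (b :* d) ; v = a :* d :+ b :* c :+ b :* d in
      u :* u :+ u :* v :+ M :* (v :* v)
      := (a :* a :+ a :* b :+ M :* (b :* b)) :* (c :* c :+ c :* d :+ M :* (d :* d))) refl a b c d (mℚ m)

  ⊗-scalarˡ : ∀ c a b → (c , 0ℚ) ⊗ (a , b) ≡ (c ℚ.* a , c ℚ.* b)
  ⊗-scalarˡ c a b = cong₂ _,_
    (solve 4 (λ c a b M → c :* a :- M :* (con 0ℚ :* b) := c :* a) refl c a b (mℚ m))
    (solve 3 (λ c a b → c :* b :+ con 0ℚ :* a :+ con 0ℚ :* b := c :* b) refl c a b)

  ⊗-inverse-scalarˡ : ∀ {σ} C p q → fromℤ C ℚ.* σ ≡ 1ℚ →
    (σ , 0ℚ) ⊗ toK (C ℤ.* p , C ℤ.* q) ≡ toK (p , q)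
  ⊗-inverse-scalarˡ {σ} C p q Cσ≡1 = begin
    (σ , 0ℚ) ⊗ toK (C ℤ.* p , C ℤ.* q)
      ≡⟨ cong₂ (λ x y → (σ , 0ℚ) ⊗ (x , y)) (fromℤ-homo-* C p) (fromℤ-homo-* C q) ⟩
    (σ , 0ℚ) ⊗ (fromℤ C ℚ.* fromℤ p , fromℤ C ℚ.* fromℤ q)
      ≡⟨ ⊗-scalarˡ σ _ _ ⟩
    (σ ℚ.* (fromℤ C ℚ.* fromℤ p) , σ ℚ.* (fromℤ C ℚ.* fromℤ q))
      ≡⟨ cong₂ _,_ (cancel (fromℤ p)) (cancel (fromℤ q)) ⟩
    toK (p , q) ∎
    where
    open ≡-Reasoning
    cancel : ∀ x → σ ℚ.* (fromℤ C ℚ.* x) ≡ x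
    cancel x = trans (solve 3 (λ σ c x → σ :* (c :* x) := (c :* σ) :* x) refl σ (fromℤ C) x)
      (trans (cong (ℚ._* x) Cσ≡1) (ℚP.*-identityˡ x))

  isSubring-ℤ : IsSubringOfℚ (IsZ m)
  isSubring-ℤ = record
    { fromℤ∈ = λ z → z , refl
    ; +-closed = λ { (z , refl) (w , refl) → z ℤ.+ w , sym (fromℤ-homo-+ z w) }
    ; *-closed = λ { (z , refl) (w , refl) → z ℤ.* w , sym (fromℤ-homo-* z w) }
    ; neg-closed = λ { (z , refl) → ℤ.- z , sym (fromℤ-homo‿- z) }
    }

  private
    mᵏ : ℕ → ℚ
    mᵏ k = fromℤ (+ (m ^ k))

    mᵏ⁺ˡ≡mᵏmˡ : ∀ k l → mᵏ (k ℕ.+ l) ≡ mᵏ k ℚ.* mᵏ l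
    mᵏ⁺ˡ≡mᵏmˡ k l = trans (cong (λ n → fromℤ (+ n)) (ℕP.^-distribˡ-+-* m k l))
      (trans (cong fromℤ (ℤP.pos-* (m ^ k) (m ^ l))) (fromℤ-homo-* (+ (m ^ k)) (+ (m ^ l))))

  -- A common denominator m^(k+l) clears both summands and both factors.
  isSubring-ℤ[1/m] : IsSubringOfℚ (IsZ1/m m)
  isSubring-ℤ[1/m] = record
    { fromℤ∈ = λ z → 0 , z , ℚP.*-identityʳ (fromℤ z)
    ; +-closed = λ { {p} {q} (k , z , pmᵏ) (l , w , qmˡ) →
        k ℕ.+ l , z ℤ.* + (m ^ l) ℤ.+ w ℤ.* + (m ^ k) , (begin
          (p ℚ.+ q) ℚ.* mᵏ (k ℕ.+ l)                    ≡⟨ cong ((p ℚ.+ q) ℚ.*_) (mᵏ⁺ˡ≡mᵏmˡ k l) ⟩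
          (p ℚ.+ q) ℚ.* (mᵏ k ℚ.* mᵏ l)                 ≡⟨ solve 4 (λ p q A B → (p :+ q) :* (A :* B) := (p :* A) :* B :+ (q :* B) :* A)
                                                             refl p q (mᵏ k) (mᵏ l) ⟩
          (p ℚ.* mᵏ k) ℚ.* mᵏ l ℚ.+ (q ℚ.* mᵏ l) ℚ.* mᵏ k ≡⟨ cong₂ (λ u v → u ℚ.* mᵏ l ℚ.+ v ℚ.* mᵏ k) pmᵏ qmˡ ⟩
          fromℤ z ℚ.* mᵏ l ℚ.+ fromℤ w ℚ.* mᵏ k         ≡⟨ sym (trans (fromℤ-homo-+ (z ℤ.* _) (w ℤ.* _))
                                                             (cong₂ ℚ._+_ (fromℤ-homo-* z _) (fromℤ-homo-* w _))) ⟩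
          fromℤ (z ℤ.* + (m ^ l) ℤ.+ w ℤ.* + (m ^ k))  ∎) }
    ; *-closed = λ { {p} {q} (k , z , pmᵏ) (l , w , qmˡ) →
        k ℕ.+ l , z ℤ.* w , (begin
          (p ℚ.* q) ℚ.* mᵏ (k ℕ.+ l)        ≡⟨ cong ((p ℚ.* q) ℚ.*_) (mᵏ⁺ˡ≡mᵏmˡ k l) ⟩
          (p ℚ.* q) ℚ.* (mᵏ k ℚ.* mᵏ l)     ≡⟨ solve 4 (λ p q A B → (p :* q) :* (A :* B) := (p :* A) :* (q :* B))
                                                 refl p q (mᵏ k) (mᵏ l) ⟩
          (p ℚ.* mᵏ k) ℚ.* (q ℚ.* mᵏ l)     ≡⟨ cong₂ ℚ._*_ pmᵏ qmˡ ⟩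
          fromℤ z ℚ.* fromℤ w               ≡⟨ sym (fromℤ-homo-* z w) ⟩
          fromℤ (z ℤ.* w)                   ∎) }
    ; neg-closed = λ { {p} (k , z , pmᵏ) → k , ℤ.- z ,
        trans (sym (ℚP.neg-distribˡ-* p _)) (trans (cong ℚ.-_ pmᵏ) (sym (fromℤ-homo‿- z))) }
    }
    where open ≡-Reasoning

  ⊗-inverse-scalar-middle : ∀ {σ} C x y p q → fromℤ C ℚ.* σ ≡ 1ℚ → mulℤ² (+ m) x y ≡ C ·ℤ² (p , q) →
    toK x ⊗ ((σ , 0ℚ) ⊗ toK y) ≡ toK (p , q)
  ⊗-inverse-scalar-middle {σ} C x y p q Cσ≡1 xy≡Cpq = begin
    toK x ⊗ ((σ , 0ℚ) ⊗ toK y)  ≡⟨ sym (⊗-assoc (toK x) (σ , 0ℚ) (toK y)) ⟩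
    toK x ⊗ (σ , 0ℚ) ⊗ toK y    ≡⟨ cong (_⊗ toK y) (⊗-comm (toK x) (σ , 0ℚ)) ⟩
    (σ , 0ℚ) ⊗ toK x ⊗ toK y    ≡⟨ ⊗-assoc (σ , 0ℚ) (toK x) (toK y) ⟩
    (σ , 0ℚ) ⊗ (toK x ⊗ toK y)  ≡⟨ cong ((σ , 0ℚ) ⊗_) (trans (sym (toK-homo-* x y)) (cong toK xy≡Cpq)) ⟩
    (σ , 0ℚ) ⊗ toK (C ·ℤ² (p , q)) ≡⟨ ⊗-inverse-scalarˡ C p q Cσ≡1 ⟩
    toK (p , q)                 ∎
    where open ≡-Reasoning

  lincomb : ∀ {n} → Vec K n → Vec K n → K
  lincomb cs v = sumK m (zipWith _⊗_ cs v)

  lincomb-0 : ∀ {n} (v : Vec K n) → lincomb (Vec.replicate n (0K m)) v ≡ 0K m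
  lincomb-0 [] = refl
  lincomb-0 (x ∷ v) = trans (cong₂ _⊕_ (⊗-zeroˡ x) (lincomb-0 v)) (⊕-identityˡ (0K m))

  lincomb-⊕ : ∀ {n} (cs ds v : Vec K n) → lincomb (zipWith _⊕_ cs ds) v ≡ lincomb cs v ⊕ lincomb ds v
  lincomb-⊕ [] [] [] = sym (⊕-identityˡ (0K m))
  lincomb-⊕ (c ∷ cs) (d ∷ ds) (x ∷ v) =
    trans (cong₂ _⊕_ (⊗-distribʳ-⊕ c d x) (lincomb-⊕ cs ds v))
      (⊕-interchange (c ⊗ x) (d ⊗ x) (lincomb cs v) (lincomb ds v))

  lincomb-⊗ : ∀ {n} c (cs v : Vec K n) → lincomb (Vec.map (c ⊗_) cs) v ≡ c ⊗ lincomb cs v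
  lincomb-⊗ c [] [] = sym (⊗-zeroʳ c)
  lincomb-⊗ c (d ∷ cs) (x ∷ v) =
    trans (cong₂ _⊕_ (⊗-assoc c d x) (lincomb-⊗ c cs v)) (sym (⊗-distribˡ-⊕ (d ⊗ x) (lincomb cs v) c))

  basisVector : ∀ {n} → Fin n → Vec K n
  basisVector {suc n} Fin.zero = 1K m ∷ Vec.replicate n (0K m)
  basisVector (Fin.suc i) = 0K m ∷ basisVector i

  lincomb-basisVector : ∀ {n} (i : Fin n) (v : Vec K n) → lincomb (basisVector i) v ≡ lookup v i
  lincomb-basisVector Fin.zero (x ∷ v) = trans (cong₂ _⊕_ (⊗-identityˡ x) (lincomb-0 v)) (⊕-identityʳ x)
  lincomb-basisVector (Fin.suc i) (x ∷ v) = trans (cong₂ _⊕_ (⊗-zeroˡ x) (lincomb-basisVector i v)) (⊕-identityˡ _)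

  module Span {B : ℚ → Set} (B-subring : IsSubringOfℚ B) where
    open IsSubringOfℚ B-subring

    Integral : K → Set
    Integral = InOrder m B

    integral-toK : ∀ p → Integral (toK p)
    integral-toK (a , b) = fromℤ∈ a , fromℤ∈ b

    integral-⊕ : ∀ {x y} → Integral x → Integral y → Integral (x ⊕ y)
    integral-⊕ {_ , _} {_ , _} (a , b) (c , d) = +-closed a c , +-closed b d

    integral-⊗ : ∀ {x y} → Integral x → Integral y → Integral (x ⊗ y)
    integral-⊗ {_ , _} {_ , _} (a , b) (c , d) =
      +-closed (*-closed a c) (neg-closed (*-closed (fromℤ∈ (+ m)) (*-closed b d))) ,
      +-closed (+-closed (*-closed a d) (*-closed b c)) (*-closed b d)

    _∈_ : K → Gens m → Set
    x ∈ g = _∈⟨_⟩_ m x B g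

    ∈-⊕ : ∀ {g x y} → x ∈ g → y ∈ g → (x ⊕ y) ∈ g
    ∈-⊕ {g} (cs , cs-int , refl) (ds , ds-int , refl) =
      zipWith _⊕_ cs ds , integral-zipWith cs-int ds-int , sym (lincomb-⊕ cs ds (elems g))
      where
      integral-zipWith : ∀ {n} {cs ds : Vec K n} → VAll.All Integral cs → VAll.All Integral ds →
        VAll.All Integral (zipWith _⊕_ cs ds)
      integral-zipWith [] [] = []
      integral-zipWith (c ∷ cs) (d ∷ ds) = integral-⊕ c d ∷ integral-zipWith cs ds

    ∈-⊗ : ∀ {g c x} → Integral c → x ∈ g → (c ⊗ x) ∈ g
    ∈-⊗ {g} {c} c-int (cs , cs-int , refl) =
      Vec.map (c ⊗_) cs , VAllP.map⁺ (VAll.map (integral-⊗ c-int) cs-int) , sym (lincomb-⊗ c cs (elems g))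

    generator∈ : ∀ g (i : Fin (size g)) → lookup (elems g) i ∈ g
    generator∈ g i = basisVector i , basisVector-integral i , sym (lincomb-basisVector i (elems g))
      where
      replicate-0-integral : ∀ n → VAll.All Integral (Vec.replicate n (0K m))
      replicate-0-integral zero = []
      replicate-0-integral (suc n) = integral-toK (+ 0 , + 0) ∷ replicate-0-integral n
      basisVector-integral : ∀ {n} (i : Fin n) → VAll.All Integral (basisVector i)
      basisVector-integral {suc n} Fin.zero = integral-toK (+ 1 , + 0) ∷ replicate-0-integral n
      basisVector-integral (Fin.suc i) = integral-toK (+ 0 , + 0) ∷ basisVector-integral i

    span-induction : (P : K → Set) → P (0K m) → (∀ {x y} → P x → P y → P (x ⊕ y)) →
      (∀ {c x} → Integral c → P x → P (c ⊗ x)) →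
      ∀ g → VAll.All P (elems g) → ∀ {x} → x ∈ g → P x
    span-induction P P0 P⊕ P⊗ g P-gens (cs , cs-int , refl) = go cs (elems g) cs-int P-gens
      where
      go : ∀ {n} (cs v : Vec K n) → VAll.All Integral cs → VAll.All P v → P (lincomb cs v)
      go [] [] [] [] = P0
      go (c ∷ cs) (x ∷ v) (c-int ∷ cs-int) (Px ∷ Pv) = P⊕ (P⊗ c-int Px) (go cs v cs-int Pv)

    ∈-unitIdeal⇒integral : ∀ {x} → x ∈ unitIdeal m → Integral x
    ∈-unitIdeal⇒integral ((c ∷ []) , (c-int ∷ []) , refl) =
      subst Integral (sym (trans (⊕-identityʳ (c ⊗ 1K m)) (⊗-identityʳ c))) c-int

    sameModule-unitIdeal : ∀ g → VAll.All Integral (elems g) → 1K m ∈ g → SameModule m B g (unitIdeal m)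
    sameModule-unitIdeal g gens-int 1∈g x = mk⇔
      (λ x∈g → (x ∷ []) , (span-induction Integral (integral-toK (+ 0 , + 0)) integral-⊕ integral-⊗ g gens-int x∈g ∷ []) ,
               sym (trans (⊕-identityʳ (x ⊗ 1K m)) (⊗-identityʳ x)))
      (λ x∈A → subst (_∈ g) (⊗-identityʳ x) (∈-⊗ (∈-unitIdeal⇒integral x∈A) 1∈g))

    -- γ = γ · 1 ∈ g and det (1 , γ) = 1.
    fullRank-of-1∈ : ∀ g → 1K m ∈ g → FullRank m B g
    fullRank-of-1∈ g 1∈g = 1K m , toK (+ 0 , + 1) , 1∈g ,
      subst (_∈ g) (⊗-identityʳ _) (∈-⊗ (integral-toK (+ 0 , + 1)) 1∈g) , λ ()

  InLattice : ℕ → K → Set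
  InLattice c x = ∃[ k ] ∃[ y ] x ≡ toK (latticePoint (+ c ℤ.* + c) (+ m) k y)

  -- 𝔞 c = (c , γ)²; when c ∣ m, its ℤ-basis is c² , γ − m.
  𝔞 : ℕ → Gens m
  𝔞 c = gens 2 (toK (+ c ℤ.* + c , + 0) ∷ toK (ℤ.- + m , + 1) ∷ [])

  module _ (c g : ℕ) (m≡cg : m ≡ c ℕ.* g) where
    open Span isSubring-ℤ

    private
      C² : ℤ
      C² = + c ℤ.* + c

    span-𝔞⊆lattice : ∀ {x} → x ∈ 𝔞 c → InLattice c x
    span-𝔞⊆lattice = span-induction (InLattice c) lattice-0 lattice-⊕ lattice-⊗ (𝔞 c)
      ((+ 1 , + 0 , cong toK (sym (proj₁ basis))) ∷ (+ 0 , + 1 , cong toK (sym (proj₂ basis))) ∷ [])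
      where
      basis = latticePoint-basis C² (+ m)
      lattice-0 : InLattice c (0K m)
      lattice-0 = + 0 , + 0 , cong toK (sym (latticePoint-0 C² (+ m)))
      lattice-⊕ : ∀ {x y} → InLattice c x → InLattice c y → InLattice c (x ⊕ y)
      lattice-⊕ (k₁ , y₁ , refl) (k₂ , y₂ , refl) = k₁ ℤ.+ k₂ , y₁ ℤ.+ y₂ ,
        trans (sym (toK-homo-+ (latticePoint C² (+ m) k₁ y₁) (latticePoint C² (+ m) k₂ y₂)))
          (cong toK (latticePoint-+ C² (+ m) k₁ y₁ k₂ y₂))
      lattice-⊗ : ∀ {a x} → Integral a → InLattice c x → InLattice c (a ⊗ x)
      lattice-⊗ ((s , refl) , (t , refl)) (k , y , refl) =
        s ℤ.* k ℤ.+ + m ℤ.* t ℤ.* k ℤ.- + g ℤ.* + g ℤ.* t ℤ.* y , s ℤ.* y ℤ.+ t ℤ.* (k ℤ.* C² ℤ.- + m ℤ.* y) ℤ.+ t ℤ.* y ,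
        trans (sym (toK-homo-* (s , t) (latticePoint C² (+ m) k y)))
          (cong toK (latticePoint-* (+ c) (+ g) (trans (cong +_ m≡cg) (ℤP.pos-* c g)) s t k y))

    det-lattice : ∀ {x y} → InLattice c x → InLattice c y → ∃[ b ] IsZ m b × det m x y ≡ b ℚ.* fromℤ C²
    det-lattice (k₁ , y₁ , refl) (k₂ , y₂ , refl) = fromℤ (k₁ ℤ.* y₂ ℤ.- y₁ ℤ.* k₂) , (k₁ ℤ.* y₂ ℤ.- y₁ ℤ.* k₂ , refl) ,
      trans (det-toK (latticePoint C² (+ m) k₁ y₁) (latticePoint C² (+ m) k₂ y₂))
        (trans (cong fromℤ (det-latticePoint C² (+ m) k₁ y₁ k₂ y₂)) (fromℤ-homo-* (k₁ ℤ.* y₂ ℤ.- y₁ ℤ.* k₂) C²))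

  oriented𝔞 : ℕ → Gens m × ℚ
  oriented𝔞 c = (𝔞 c , fromℤ (+ c ℤ.* + c))

  module _ (d f : ℕ) (m≡df : m ≡ d ℕ.* f) .{{d≢0 : ℕ.NonZero d}} where
    private
      D F D² : ℤ
      D = + d
      F = + f
      D² = D ℤ.* D

      M≡DF : + m ≡ D ℤ.* F
      M≡DF = trans (cong +_ m≡df) (ℤP.pos-* d f)

      instance
        d*d≢0 : ℕ.NonZero (d ℕ.* d)
        d*d≢0 = ℕP.m*n≢0 d d

      D²≢0 : D² ≢ + 0
      D²≢0 eq = ℕ.≢-nonZero⁻¹ (d ℕ.* d) (ℤP.+-injective (trans (ℤP.pos-* d d) eq))

      ρ : ℚ
      ρ = + 1 / (d ℕ.* d)

      D²ρ≡1 : fromℤ D² ℚ.* ρ ≡ 1ℚ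
      D²ρ≡1 = trans (cong (λ z → fromℤ z ℚ.* ρ) (sym (ℤP.pos-* d d))) (fromℤ-*-inverse (d ℕ.* d))

    -- The inverse of 𝔞 d is its conjugate divided by its norm d².
    𝔞⁻¹ : Gens m
    𝔞⁻¹ = scale m (ρ , 0ℚ) (gens 2 (toK (D² , + 0) ∷ toK (+ 1 ℤ.- + m , ℤ.- + 1) ∷ []))

    private
      module ℤ[γ] = Span isSubring-ℤ
      module ℤ[1/m][γ] = Span isSubring-ℤ[1/m]

      c²∈𝔞 : ℤ[γ]._∈_ (toK (D² , + 0)) (𝔞 d)
      c²∈𝔞 = ℤ[γ].generator∈ (𝔞 d) (# 0)

      γ-m∈𝔞 : ℤ[γ]._∈_ (toK (ℤ.- + m , + 1)) (𝔞 d)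
      γ-m∈𝔞 = ℤ[γ].generator∈ (𝔞 d) (# 1)

      det-basis : det m (toK (D² , + 0)) (toK (ℤ.- + m , + 1)) ≡ fromℤ D²
      det-basis = trans (det-toK (D² , + 0) (ℤ.- + m , + 1)) (cong fromℤ (detℤ²-basis D² (+ m)))

    𝔞𝔞⁻¹≡A : SameModule m (IsZ m) (prodIdeal m (𝔞 d) 𝔞⁻¹) (unitIdeal m)
    𝔞𝔞⁻¹≡A = ℤ[γ].sameModule-unitIdeal 𝔞𝔞⁻¹ products-integral 1∈𝔞𝔞⁻¹
      where
      𝔞𝔞⁻¹ = prodIdeal m (𝔞 d) 𝔞⁻¹
      products = conjugate-products D F M≡DF
      c² γ-m c̄² γ̄-m : ℤ²
      c² = (D² , + 0)
      γ-m = (ℤ.- + m , + 1)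
      c̄² = (D² , + 0)
      γ̄-m = (+ 1 ℤ.- + m , ℤ.- + 1)
      p₁₁ = ⊗-inverse-scalar-middle D² c² c̄² _ _ D²ρ≡1 (proj₁ products)
      p₁₂ = ⊗-inverse-scalar-middle D² c² γ̄-m _ _ D²ρ≡1 (proj₁ (proj₂ products))
      p₂₁ = ⊗-inverse-scalar-middle D² γ-m c̄² _ _ D²ρ≡1 (proj₁ (proj₂ (proj₂ products)))
      p₂₂ = ⊗-inverse-scalar-middle D² γ-m γ̄-m _ _ D²ρ≡1 (proj₂ (proj₂ (proj₂ products)))
      integral : ∀ {x} t → x ≡ toK t → ℤ[γ].Integral x
      integral t refl = ℤ[γ].integral-toK t
      products-integral : VAll.All ℤ[γ].Integral (elems 𝔞𝔞⁻¹)
      products-integral = integral c² p₁₁ ∷ integral γ̄-m p₁₂ ∷ integral γ-m p₂₁ ∷ integral (F ℤ.* F , + 0) p₂₂ ∷ []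
      1∈𝔞𝔞⁻¹ : ℤ[γ]._∈_ (1K m) 𝔞𝔞⁻¹
      1∈𝔞𝔞⁻¹ = subst (ℤ[γ]._∈ 𝔞𝔞⁻¹) combination
        (ℤ[γ].∈-⊕ (ℤ[γ].∈-⊗ (ℤ[γ].integral-toK a₁) (ℤ[γ].generator∈ 𝔞𝔞⁻¹ (# 1)))
                  (ℤ[γ].∈-⊗ (ℤ[γ].integral-toK a₂) (ℤ[γ].generator∈ 𝔞𝔞⁻¹ (# 2))))
        where
        a₁ a₂ : ℤ²
        a₁ = (+ 1 , + 2)
        a₂ = (+ 3 , ℤ.- + 2)
        combination : toK a₁ ⊗ lookup (elems 𝔞𝔞⁻¹) (# 1) ⊕ toK a₂ ⊗ lookup (elems 𝔞𝔞⁻¹) (# 2) ≡ 1K m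
        combination = begin
          toK a₁ ⊗ lookup (elems 𝔞𝔞⁻¹) (# 1) ⊕ toK a₂ ⊗ lookup (elems 𝔞𝔞⁻¹) (# 2)
            ≡⟨ cong₂ (λ u v → toK a₁ ⊗ u ⊕ toK a₂ ⊗ v) p₁₂ p₂₁ ⟩
          toK a₁ ⊗ toK γ̄-m ⊕ toK a₂ ⊗ toK γ-m
            ≡⟨ sym (cong₂ _⊕_ (toK-homo-* a₁ γ̄-m) (toK-homo-* a₂ γ-m)) ⟩
          toK (mulℤ² (+ m) a₁ γ̄-m) ⊕ toK (mulℤ² (+ m) a₂ γ-m)
            ≡⟨ sym (toK-homo-+ (mulℤ² (+ m) a₁ γ̄-m) (mulℤ² (+ m) a₂ γ-m)) ⟩
          toK (mulℤ² (+ m) a₁ γ̄-m +ℤ² mulℤ² (+ m) a₂ γ-m)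
            ≡⟨ cong toK (γ-M-comaximal (+ m)) ⟩
          1K m ∎
          where open ≡-Reasoning

    𝔞-fullRank : FracIdeal m (IsZ m) (𝔞 d)
    𝔞-fullRank = toK (D² , + 0) , toK (ℤ.- + m , + 1) , c²∈𝔞 , γ-m∈𝔞 ,
      λ det≡0 → D²≢0 (fromℤ-injective (trans (sym det-basis) det≡0))

    𝔞-invertible : Invertible m (IsZ m) (𝔞 d)
    𝔞-invertible = 𝔞-fullRank , 𝔞⁻¹ , ℤ[γ].fullRank-of-1∈ 𝔞⁻¹ 1∈𝔞⁻¹ , 𝔞𝔞⁻¹≡A
      where
      1∈𝔞⁻¹ : ℤ[γ]._∈_ (1K m) 𝔞⁻¹
      1∈𝔞⁻¹ = subst (ℤ[γ]._∈ 𝔞⁻¹)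
        (trans (cong₂ (λ u v → (ρ , 0ℚ) ⊗ toK (u , v)) (sym (ℤP.*-identityʳ D²)) (sym (ℤP.*-zeroʳ D²)))
          (⊗-inverse-scalarˡ D² (+ 1) (+ 0) D²ρ≡1))
        (ℤ[γ].generator∈ 𝔞⁻¹ (# 0))

    𝔞-generatesNorm : GeneratesNorm m (IsZ m) (𝔞 d) (fromℤ D²)
    𝔞-generatesNorm = (λ κ≡0 → D²≢0 (fromℤ-injective κ≡0)) , κ∈N𝔞 ,
      λ x y x∈𝔞 y∈𝔞 → det-lattice d f m≡df (span-𝔞⊆lattice d f m≡df x∈𝔞) (span-𝔞⊆lattice d f m≡df y∈𝔞)
      where
      κ∈N𝔞 : InNorm m (IsZ m) (𝔞 d) (fromℤ D²)
      κ∈N𝔞 = 1 , 1ℚ ∷ [] , toK (D² , + 0) ∷ [] , toK (ℤ.- + m , + 1) ∷ [] , (+ 1 , refl) ∷ [] , c²∈𝔞 ∷ [] , γ-m∈𝔞 ∷ [] ,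
        sym (trans (ℚP.+-identityʳ _) (trans (ℚP.*-identityˡ _) det-basis))

    oriented𝔞-invertible : OrientedInvertible m (IsZ m) (oriented𝔞 d)
    oriented𝔞-invertible = 𝔞-invertible , 𝔞-generatesNorm

    private
      r : ℚ
      r = + 1 / d

      Dr≡1 : fromℤ D ℚ.* r ≡ 1ℚ
      Dr≡1 = fromℤ-*-inverse d

    -- 1/d = f/m
    d⁻¹∈ℤ[1/m] : IsZ1/m m r
    d⁻¹∈ℤ[1/m] = 1 , F , (begin
      r ℚ.* fromℤ (+ (m ℕ.* 1))     ≡⟨ cong (λ n → r ℚ.* fromℤ (+ n)) (ℕP.*-identityʳ m) ⟩
      r ℚ.* fromℤ (+ m)             ≡⟨ cong (λ z → r ℚ.* fromℤ z) M≡DF ⟩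
      r ℚ.* fromℤ (D ℤ.* F)         ≡⟨ cong (r ℚ.*_) (fromℤ-homo-* D F) ⟩
      r ℚ.* (fromℤ D ℚ.* fromℤ F)   ≡⟨ solve 3 (λ r D F → r :* (D :* F) := (D :* r) :* F) refl r (fromℤ D) (fromℤ F) ⟩
      fromℤ D ℚ.* r ℚ.* fromℤ F     ≡⟨ cong (ℚ._* fromℤ F) Dr≡1 ⟩
      1ℚ ℚ.* fromℤ F                ≡⟨ ℚP.*-identityˡ (fromℤ F) ⟩
      fromℤ F                       ∎)
      where open ≡-Reasoning

    d⁻¹𝔞≡R : SameModule m (IsZ1/m m) (scale m (r , 0ℚ) (𝔞 d)) (unitIdeal m)
    d⁻¹𝔞≡R = ℤ[1/m][γ].sameModule-unitIdeal d⁻¹𝔞 generators-integral 1∈d⁻¹𝔞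
      where
      open IsSubringOfℚ isSubring-ℤ[1/m]
      d⁻¹𝔞 = scale m (r , 0ℚ) (𝔞 d)
      d⁻¹c² : (r , 0ℚ) ⊗ toK (D² , + 0) ≡ toK (D , + 0)
      d⁻¹c² = trans (cong (λ z → (r , 0ℚ) ⊗ toK (D² , z)) (sym (ℤP.*-zeroʳ D))) (⊗-inverse-scalarˡ D D (+ 0) Dr≡1)
      generators-integral : VAll.All ℤ[1/m][γ].Integral (elems d⁻¹𝔞)
      generators-integral = subst ℤ[1/m][γ].Integral (sym d⁻¹c²) (ℤ[1/m][γ].integral-toK (D , + 0)) ∷
        subst ℤ[1/m][γ].Integral (sym (⊗-scalarˡ r (fromℤ (ℤ.- + m)) 1ℚ))
          (*-closed {r} {fromℤ (ℤ.- + m)} d⁻¹∈ℤ[1/m] (fromℤ∈ (ℤ.- + m)) , *-closed {r} {1ℚ} d⁻¹∈ℤ[1/m] (fromℤ∈ (+ 1))) ∷ []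
      1∈d⁻¹𝔞 : ℤ[1/m][γ]._∈_ (1K m) d⁻¹𝔞
      1∈d⁻¹𝔞 = subst (ℤ[1/m][γ]._∈ d⁻¹𝔞)
        (trans (cong ((r , 0ℚ) ⊗_) d⁻¹c²)
          (trans (cong₂ (λ u v → (r , 0ℚ) ⊗ toK (u , v)) (sym (ℤP.*-identityʳ D)) (sym (ℤP.*-zeroʳ D)))
            (⊗-inverse-scalarˡ D (+ 1) (+ 0) Dr≡1)))
        (ℤ[1/m][γ].∈-⊗ {c = r , 0ℚ} (d⁻¹∈ℤ[1/m] , fromℤ∈ (+ 0)) (ℤ[1/m][γ].generator∈ d⁻¹𝔞 (# 0)))

    𝔞∈kernel : InKernel m (oriented𝔞 d)
    𝔞∈kernel = (r , 0ℚ) , d⁻¹≢0 , d⁻¹𝔞≡R , sym N[d⁻¹]d²≡1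
      where
      d⁻¹≢0 : (r , 0ℚ) ≢ 0K m
      d⁻¹≢0 d⁻¹≡0 with trans (sym (ℚP.*-zeroʳ (fromℤ D))) (trans (cong (fromℤ D ℚ.*_) (sym (cong proj₁ d⁻¹≡0))) Dr≡1)
      ... | ()
      N[d⁻¹]d²≡1 : NK m (r , 0ℚ) ℚ.* fromℤ D² ≡ 1ℚ
      N[d⁻¹]d²≡1 = begin
        NK m (r , 0ℚ) ℚ.* fromℤ D²                ≡⟨ cong (NK m (r , 0ℚ) ℚ.*_) (fromℤ-homo-* D D) ⟩
        NK m (r , 0ℚ) ℚ.* (fromℤ D ℚ.* fromℤ D)   ≡⟨ solve 3 (λ r D M → (r :* r :+ r :* con 0ℚ :+ M :* (con 0ℚ :* con 0ℚ)) :* (D :* D)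
                                                        := (D :* r) :* (D :* r)) refl r (fromℤ D) (mℚ m) ⟩
        (fromℤ D ℚ.* r) ℚ.* (fromℤ D ℚ.* r)       ≡⟨ cong₂ ℚ._*_ Dr≡1 Dr≡1 ⟩
        1ℚ                                        ∎
        where open ≡-Reasoning

  𝔞-inequivalent : ∀ d e g → m ≡ e ℕ.* g → 1 ≤ d → d < e → e ℕ.* e ℕ.* (e ℕ.* e) < m →
    ¬ Equiv m (IsZ m) (oriented𝔞 d) (oriented𝔞 e)
  𝔞-inequivalent d e g m≡eg 1≤d d<e e⁴<m (α , _ , α𝔞d≡𝔞e , κe≡Nα·κd) =
    absurd (span-𝔞⊆lattice e g m≡eg (Equivalence.to (α𝔞d≡𝔞e x) (Span.generator∈ isSubring-ℤ (scale m α (𝔞 d)) (# 0))))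
    where
    D² E² : ℤ
    D² = + d ℤ.* + d
    E² = + e ℤ.* + e
    -- α · d², kept in this form: unifying membership types against α ⊗ toK (D² , + 0)
    -- makes the checker normalise rational arithmetic.
    x : K
    x = lookup (elems (scale m α (𝔞 d))) (# 0)
    n : ℕ
    n = e ℕ.* e ℕ.* (d ℕ.* d)
    instance
      m≢0 : ℕ.NonZero m
      m≢0 = ℕ.>-nonZero (ℕP.<-≤-trans (s≤s z≤n) e⁴<m)
    n<e⁴ : n < e ℕ.* e ℕ.* (e ℕ.* e)
    n<e⁴ = ℕP.*-monoʳ-< (e ℕ.* e) {{e²≢0}} (ℕP.*-mono-< d<e d<e)
      where e²≢0 = ℕ.>-nonZero (ℕP.*-mono-< (ℕP.<-trans 1≤d d<e) (ℕP.<-trans 1≤d d<e))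
    n≢0 : n ≢ 0
    n≢0 n≡0 = ℕP.<-irrefl (sym n≡0) (ℕP.*-mono-< (ℕP.*-mono-< (ℕP.<-trans 1≤d d<e) (ℕP.<-trans 1≤d d<e)) (ℕP.*-mono-< 1≤d 1≤d))
    normℤ²-integer : ∀ C M → normℤ² M (C , + 0) ≡ C ℤ.* C
    normℤ²-integer C M = expanded
      where
      expanded : C ℤ.* C ℤ.+ C ℤ.* + 0 ℤ.+ M ℤ.* (+ 0 ℤ.* + 0) ≡ C ℤ.* C
      expanded = ℤSolver.solve (C List.∷ M List.∷ List.[])
    n≡Nx : fromℤ (+ n) ≡ NK m x
    n≡Nx = begin
      fromℤ (+ n)                             ≡⟨ cong fromℤ (trans (ℤP.pos-* (e ℕ.* e) (d ℕ.* d)) (cong₂ ℤ._*_ (ℤP.pos-* e e) (ℤP.pos-* d d))) ⟩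
      fromℤ (E² ℤ.* D²)                       ≡⟨ fromℤ-homo-* E² D² ⟩
      fromℤ E² ℚ.* fromℤ D²                   ≡⟨ cong (ℚ._* fromℤ D²) κe≡Nα·κd ⟩
      NK m α ℚ.* fromℤ D² ℚ.* fromℤ D²         ≡⟨ ℚP.*-assoc (NK m α) (fromℤ D²) (fromℤ D²) ⟩
      NK m α ℚ.* (fromℤ D² ℚ.* fromℤ D²)       ≡⟨ cong (NK m α ℚ.*_) (sym (fromℤ-homo-* D² D²)) ⟩
      NK m α ℚ.* fromℤ (D² ℤ.* D²)             ≡⟨ cong (λ z → NK m α ℚ.* fromℤ z) (sym (normℤ²-integer D² (+ m))) ⟩
      NK m α ℚ.* fromℤ (normℤ² (+ m) (D² , + 0)) ≡⟨ cong (NK m α ℚ.*_) (sym (NK-toK (D² , + 0))) ⟩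
      NK m α ℚ.* NK m (toK (D² , + 0))         ≡⟨ sym (NK-homo-* α (toK (D² , + 0))) ⟩
      NK m x                                  ∎
      where open ≡-Reasoning
    absurd : InLattice e x → ⊥
    absurd (k , y , x≡) = [ (λ m≤n → ℕP.<-irrefl refl (ℕP.<-≤-trans (ℕP.<-trans n<e⁴ e⁴<m) m≤n))
                          , (λ e⁴≤n → ℕP.<-irrefl refl (ℕP.<-≤-trans n<e⁴ e⁴≤n)) ]′
                          (latticeNorm-≥ m e k y n n≢0 (fromℤ-injective (trans n≡Nx (trans (cong (NK m) x≡) (NK-toK (latticePoint E² (+ m) k y))))))

allPairs-map-All : ∀ {a p r s} {A : Set a} {P : Pred A p} {R : Rel A r} {S : Rel A s} →
  (∀ {x y} → P x → P y → R x y → S x y) → ∀ {xs} → All P xs → AllPairs R xs → AllPairs S xs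
allPairs-map-All f [] [] = []
allPairs-map-All f (px ∷ pxs) (Rxs ∷ Rxss) =
  All.zipWith (λ (py , Rxy) → f px py Rxy) (pxs , Rxs) ∷ allPairs-map-All f pxs Rxss

length-filter+length-filter-∁ : ∀ {a p} {A : Set a} {P : Pred A p} (P? : Decidable P) xs →
  length (filter P? xs) ℕ.+ length (filter (∁? P?) xs) ≡ length xs
length-filter+length-filter-∁ P? [] = refl
length-filter+length-filter-∁ P? (x ∷ xs) with P? x
... | yes _ = cong suc (length-filter+length-filter-∁ P? xs)
... | no _ = trans (ℕP.+-suc _ _) (cong suc (length-filter+length-filter-∁ P? xs))

prime∤product-of-larger-primes : ∀ {p qs} → Prime p → All (p <_) qs → All Prime qs → ¬ p ∣ product qs
prime∤product-of-larger-primes pp [] [] p∣1 = ℕ.nonTrivial⇒≢1 {{prime⇒nonTrivial pp}} (∣1⇒≡1 p∣1)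
prime∤product-of-larger-primes {p} {q ∷ qs} pp (p<q ∷ p<qs) (pq ∷ pqs) p∣qQ with euclidsLemma q (product qs) pp p∣qQ
... | inj₂ p∣Q = prime∤product-of-larger-primes pp p<qs pqs p∣Q
... | inj₁ p∣q = [ ℕ.nonTrivial⇒≢1 {{prime⇒nonTrivial pp}} , (λ p≡q → ℕP.<-irrefl p≡q p<q) ]′ (prime⇒irreducible pq p∣q)

product-of-increasing-primes-∣ : ∀ {n ps} → AllPairs _<_ ps → All Prime ps → All (_∣ n) ps → product ps ∣ n
product-of-increasing-primes-∣ {n} [] [] [] = 1∣ n
product-of-increasing-primes-∣ {n} {p ∷ ps} (p<ps ∷ increasing) (pp ∷ pps) (p∣n ∷ ps∣n)
  with product-of-increasing-primes-∣ increasing pps ps∣n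
... | divides q n≡qP with euclidsLemma q (product ps) pp (subst (p ∣_) n≡qP p∣n)
...   | inj₁ p∣q = subst (p ℕ.* product ps ∣_) (sym n≡qP) (*-monoˡ-∣ (product ps) p∣q)
...   | inj₂ p∣P = ⊥-elim (prime∤product-of-larger-primes pp p<ps pps p∣P)

isPrimeDivisor? : ∀ m → Decidable (λ p → Prime p × p ∣ m)
isPrimeDivisor? m p = prime? p ×-dec p ∣? m

primeDivisors : ℕ → List ℕ
primeDivisors m = filter (isPrimeDivisor? m) (upTo (suc m))

primeDivisors-increasing : ∀ m → AllPairs _<_ (primeDivisors m)
primeDivisors-increasing m = APP.filter⁺ (isPrimeDivisor? m) (APP.applyUpTo⁺₁ id (suc m) (λ i<j _ → i<j))

primeDivisors-prime-∣ : ∀ m → All (λ p → Prime p × p ∣ m) (primeDivisors m)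
primeDivisors-prime-∣ m = AllP.all-filter (isPrimeDivisor? m) (upTo (suc m))

Small : ℕ → ℕ → Set
Small m p = p ℕ.* p ℕ.* (p ℕ.* p) < m

small? : ∀ m → Decidable (Small m)
small? m p = p ℕ.* p ℕ.* (p ℕ.* p) ℕ.<? m

large-prime-divisors-≤3 : ∀ {m} .{{_ : ℕ.NonZero m}} ps → AllPairs _<_ ps →
  All (λ p → Prime p × p ∣ m) ps → All (∁ (Small m)) ps → length ps ≤ 3
large-prime-divisors-≤3 [] _ _ _ = z≤n
large-prime-divisors-≤3 (_ ∷ []) _ _ _ = s≤s z≤n
large-prime-divisors-≤3 (_ ∷ _ ∷ []) _ _ _ = s≤s (s≤s z≤n)
large-prime-divisors-≤3 (_ ∷ _ ∷ _ ∷ []) _ _ _ = s≤s (s≤s (s≤s z≤n))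
large-prime-divisors-≤3 {m} (p ∷ q ∷ r ∷ s ∷ _)
  ((p<q ∷ p<r ∷ p<s ∷ _) ∷ (q<r ∷ q<s ∷ _) ∷ (r<s ∷ _) ∷ _)
  ((pp , p∣m) ∷ (pq , q∣m) ∷ (pr , r∣m) ∷ (ps , s∣m) ∷ _) (p-large ∷ _) =
  ⊥-elim (p-large (ℕP.<-≤-trans p⁴<pqrs (∣⇒≤ pqrs∣m)))
  where
  instance
    p≢0 : ℕ.NonZero p
    p≢0 = prime⇒nonZero pp
  pqrs∣m : product (p ∷ q ∷ r ∷ s ∷ []) ∣ m
  pqrs∣m = product-of-increasing-primes-∣
    ((p<q ∷ p<r ∷ p<s ∷ []) ∷ (q<r ∷ q<s ∷ []) ∷ (r<s ∷ []) ∷ [] ∷ [])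
    (pp ∷ pq ∷ pr ∷ ps ∷ []) (p∣m ∷ q∣m ∷ r∣m ∷ s∣m ∷ [])
  p⁴<pqrs : p ℕ.* p ℕ.* (p ℕ.* p) < product (p ∷ q ∷ r ∷ s ∷ [])
  p⁴<pqrs = subst (_< product (p ∷ q ∷ r ∷ s ∷ [])) reassociate
    (ℕP.*-monoʳ-< p (ℕP.*-mono-< p<q (ℕP.*-mono-< p<r (ℕP.*-monoˡ-< 1 p<s))))
    where
    reassociate : p ℕ.* (p ℕ.* (p ℕ.* (p ℕ.* 1))) ≡ p ℕ.* p ℕ.* (p ℕ.* p)
    reassociate = ℕSolver.solve (p List.∷ List.[])

SmallPrimeDivisor : ℕ → ℕ → Set
SmallPrimeDivisor m p = (Prime p × p ∣ m) × Small m p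

smallPrimeDivisors : ℕ → List ℕ
smallPrimeDivisors m = filter (small? m) (primeDivisors m)

smallPrimeDivisors-increasing : ∀ m → AllPairs _<_ (smallPrimeDivisors m)
smallPrimeDivisors-increasing m = APP.filter⁺ (small? m) (primeDivisors-increasing m)

smallPrimeDivisors-small : ∀ m → All (SmallPrimeDivisor m) (smallPrimeDivisors m)
smallPrimeDivisors-small m =
  All.zip (AllP.filter⁺ (small? m) (primeDivisors-prime-∣ m) , AllP.all-filter (small? m) (primeDivisors m))

ω∸3≤length-smallPrimeDivisors : ∀ m .{{_ : ℕ.NonZero m}} → ω m ∸ 3 ≤ length (smallPrimeDivisors m)
ω∸3≤length-smallPrimeDivisors m = ℕP.m≤n+o⇒m∸n≤o (ω m) 3 (begin
  length (primeDivisors m)                  ≡⟨ sym (length-filter+length-filter-∁ (small? m) (primeDivisors m)) ⟩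
  #small ℕ.+ length large                   ≤⟨ ℕP.+-monoʳ-≤ #small (large-prime-divisors-≤3 large
                                                  (APP.filter⁺ (∁? (small? m)) (primeDivisors-increasing m))
                                                  (AllP.filter⁺ (∁? (small? m)) (primeDivisors-prime-∣ m))
                                                  (AllP.all-filter (∁? (small? m)) (primeDivisors m))) ⟩
  #small ℕ.+ 3                              ≡⟨ ℕP.+-comm #small 3 ⟩
  3 ℕ.+ #small                              ∎)
  where
  open ℕP.≤-Reasoning
  #small = length (smallPrimeDivisors m)
  large = filter (∁? (small? m)) (primeDivisors m)

lemma5p4 : (m : ℕ) → 1 ≤ m →
    Σ (List (Gens m × ℚ)) λ cls →
      All (OrientedInvertible m (IsZ m)) cls ×
      All (InKernel m) cls ×
      AllPairs (λ c d → ¬ Equiv m (IsZ m) c d) cls ×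
      ω m ∸ 3 ≤ length cls
lemma5p4 m 1≤m =
  List.map (oriented𝔞 m) (smallPrimeDivisors m) ,
  AllP.map⁺ (All.map orientedInvertible small) ,
  AllP.map⁺ (All.map inKernel small) ,
  APP.map⁺ (allPairs-map-All inequivalent small (smallPrimeDivisors-increasing m)) ,
  subst (ω m ∸ 3 ≤_) (sym (ListP.length-map (oriented𝔞 m) (smallPrimeDivisors m))) (ω∸3≤length-smallPrimeDivisors m)
  where
  instance
    m≢0 : ℕ.NonZero m
    m≢0 = ℕ.>-nonZero 1≤m
  small : All (SmallPrimeDivisor m) (smallPrimeDivisors m)
  small = smallPrimeDivisors-small m
  orientedInvertible : ∀ {d} → SmallPrimeDivisor m d → OrientedInvertible m (IsZ m) (oriented𝔞 m d)
  orientedInvertible ((pd , d∣m) , _) = oriented𝔞-invertible m _ _ (m∣n⇒n≡m*quotient d∣m) {{prime⇒nonZero pd}}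
  inKernel : ∀ {d} → SmallPrimeDivisor m d → InKernel m (oriented𝔞 m d)
  inKernel ((pd , d∣m) , _) = 𝔞∈kernel m _ _ (m∣n⇒n≡m*quotient d∣m) {{prime⇒nonZero pd}}
  inequivalent : ∀ {d e} → SmallPrimeDivisor m d → SmallPrimeDivisor m e → d < e →
    ¬ Equiv m (IsZ m) (oriented𝔞 m d) (oriented𝔞 m e)
  inequivalent {d} ((pd , _) , _) ((_ , e∣m) , e-small) d<e =
    𝔞-inequivalent m d _ _ (m∣n⇒n≡m*quotient e∣m) (ℕ.>-nonZero⁻¹ d {{prime⇒nonZero pd}}) d<e e-small
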